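{- Let $N_1=\{0,1\}$, $I=\mathbb{N}\times N_1$, let $\mathfrak{G}$ be the group of all permutations $\pi$ of $I$ for which there exist a permutation $\phi_\pi$ of $\mathbb{N}$ and, for each $n\in\mathbb{N}$, a permutation $\pi_n$ of $N_1$ with $\pi(n,m)=(\phi_\pi(n),\pi_n(m))$ for all $(n,m)\in I$ (equivalently, $\mathfrak{G}$ is the automorphism group of the structure $(I;\mathbf{t})$ with $\mathbf{t}=\{((n,0),(n,1)),((n,1),(n,0))\mid n\in\mathbb{N}\}$), and let $\Sigma_2=\Sigma(I,\mathfrak{G},{\cal I}_0^I)$. Then $\Sigma_2\models AC^{1,1}$.
   Context: An $n$-ary predicate on $I$ is a map $\alpha:I^n\to\{true,false\}$ with extension $\widetilde\alpha\subseteq I^n$. Permutations act on predicates by $(\pi\alpha)(\pi\xi_1,\dots,\pi\xi_n)=\alpha(\xi_1,\dots,\xi_n)$; ${\rm sym}_\mathfrak{G}(\alpha)=\{\pi\in\mathfrak{G}\mid\pi\alpha=\alpha\}$; $\mathfrak{G}(P)$ is the pointwise stabilizer in $\mathfrak{G}$ of $P\subseteq I$. ${\cal I}_0^I$ is the ideal of finite subsets of $I$. $\Sigma(I,\mathfrak{G},{\cal I}_0^I)=(J_n)_{n\ge0}$ is the second-order Henkin(–Asser) structure with individual domain $J_0=I$ in which the $n$-ary predicate variables range over $J_n=$ the set of $n$-ary predicates $\alpha$ with ${\rm sym}_\mathfrak{G}(\alpha)\supseteq\mathfrak{G}(P)$ for some finite $P\subseteq I$. $AC^{1,1}=\forall A\forall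 R\exists S(\forall x(Ax\leftrightarrow\exists yRxy)\to\forall x(Ax\to\exists!!y(Rxy\land Sxy)))$ with $A$ unary and $R,S$ binary predicate variables, where $\exists!!$ means "there exists exactly one". -}

module Defs where

open import Data.Nat using (ℕ)
open import Data.Fin using (Fin)
open import Data.Bool using (Bool; true)
open import Data.Product using (_×_; _,_; Σ; ∃; ∃-syntax)
open import Data.Vec using (Vec; map)
open import Data.List using (List)
open import Data.List.Membership.Propositional using (_∈_)
open import Function.Bundles using (_↔_; Inverse)
open import Relation.Binary.PropositionalEquality using (_≡_; _≗_)

N₁ : Set
N₁ = Fin 2

I : Set
I = ℕ × N₁

Perm : Set → Set
Perm X = X ↔ X

Pred : ℕ → Set
Pred n = Vec I n → Bool

-- action of permutations on predicates: (π α)(π ξ₁,…,π ξₙ) = α(ξ₁,…,ξₙ),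
-- i.e. (π α)(η) = α(π⁻¹ η)
_·_ : ∀ {n} → Perm I → Pred n → Pred n
(π · α) η = α (map (Inverse.from π) η)

InG : Perm I → Set
InG π = Σ (Perm ℕ) λ φ → Σ (ℕ → Perm N₁) λ ρ →
  ∀ n m → Inverse.to π (n , m) ≡ (Inverse.to φ n , Inverse.to (ρ n) m)

InGStab : List I → Perm I → Set
InGStab P π = InG π × (∀ p → p ∈ P → Inverse.to π p ≡ p)

Fixes : ∀ {n} → Perm I → Pred n → Set
Fixes π α = (π · α) ≗ α

J : (n : ℕ) → Pred n → Set
J n α = Σ (List I) λ P → ∀ π → InGStab P π → Fixes π α

ExactlyOne : (I → Set) → Set
ExactlyOne P = Σ I λ y → P y × (∀ y′ → P y′ → y′ ≡ y)

{-# OPTIONS --safe #-}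
-- Call {n} × N₁ the n-th block, and let R be supported by a finite P whose blocks all lie below M. If x has an R-successor, it
-- has one in the finite list  candidates x = (blocks below M+2) ++ [x, twin x]:  a successor
-- in any other block is moved, by a block transposition fixing P and x, into whichever of the
-- blocks M, M+1 does not contain x. Taking the first R-successor in this list is equivariant
-- under the pointwise stabiliser of the blocks below M+2, because elements of 𝔊 permute
-- blocks and hence commute with twin; so the graph of this partial choice function is in J₂.
module Submission where

open import Defs
open import Data.Bool using (Bool; true; false)
open import Data.Fin using (zero; suc) renaming (_≟_ to _≟ᶠ_)
open import Data.List using (List; []; _∷_; _++_; map; upTo; allFin; cartesianProduct; findᵇ)
open import Data.List.Extrema.Nat using (max; xs≤max)
open import Data.List.Membership.Propositional using (_∈_)
open import Data.List.Membership.Propositional.Properties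
  using (∈-++⁺ˡ; ∈-++⁺ʳ; ∈-map⁺; ∈-cartesianProduct⁺; ∈-upTo⁺; ∈-allFin)
open import Data.List.Properties using (map-++; map-id-local)
open import Data.List.Relation.Binary.Subset.Propositional using (_⊆_)
open import Data.List.Relation.Unary.All as All using ()
open import Data.List.Relation.Unary.Any using (here; there)
open import Data.Maybe as Maybe using (Maybe; just)
open import Data.Maybe.Properties using (just-injective) renaming (≡-dec to ≡-decᴹ; map-injective to map-injectiveᴹ)
open import Data.Nat using (ℕ; suc; _+_; _<_; _≤_; s≤s; _<?_) renaming (_≟_ to _≟ⁿ_)
open import Data.Nat.Properties using (≤-refl; ≤-trans; n≤1+n; 1+n≢n; <⇒≢; <-≤-trans; ≮⇒≥; m≤n+m; m≤n⇒m≤1+n; n<1+n)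
open import Data.Product using (_×_; _,_; Σ; ∃-syntax; proj₁; proj₂)
open import Data.Product.Properties using (≡-dec)
open import Data.Vec using ([]; _∷_)
open import Function using (_∘_)
open import Function.Bundles using (_⇔_; Inverse; Equivalence; Injection; mk↔ₛ′; mk⇔)
open import Function.Properties.Inverse using (↔⇒↣; ↔-refl; ↔-sym)
open import Relation.Binary.Definitions using (DecidableEquality)
open import Relation.Binary.PropositionalEquality
  using (_≡_; _≢_; refl; sym; trans; cong; cong₂; ≢-sym; module ≡-Reasoning)
open import Relation.Nullary using (yes; no; does; contradiction)
open import Relation.Nullary.Decidable using (does-⇔; dec-true)

open Inverse using (to; from)
open ≡-Reasoning

module _ {A B : Set} where

  findᵇ-map : ∀ (σ : A → B) {p : A → Bool} {q : B → Bool} → (∀ a → q (σ a) ≡ p a) →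
              ∀ xs → findᵇ q (map σ xs) ≡ Maybe.map σ (findᵇ p xs)
  findᵇ-map σ q∘σ≡p []       = refl
  findᵇ-map σ {p} q∘σ≡p (x ∷ xs) rewrite q∘σ≡p x with p x
  ... | true  = refl
  ... | false = findᵇ-map σ q∘σ≡p xs

module _ {A : Set} (p : A → Bool) where

  findᵇ-sound : ∀ xs {c} → findᵇ p xs ≡ just c → p c ≡ true
  findᵇ-sound (x ∷ xs) found with p x in px
  findᵇ-sound (x ∷ xs) refl  | true  = px
  findᵇ-sound (x ∷ xs) found | false = findᵇ-sound xs found

  findᵇ-complete : ∀ xs {w} → w ∈ xs → p w ≡ true → ∃[ c ] findᵇ p xs ≡ just c
  findᵇ-complete (x ∷ xs) w∈xs pw with p x in px
  findᵇ-complete (x ∷ xs) w∈xs        pw | true  = x , refl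
  findᵇ-complete (x ∷ xs) (here refl) pw | false = contradiction (trans (sym pw) px) λ ()
  findᵇ-complete (x ∷ xs) (there w∈xs) pw | false = findᵇ-complete xs w∈xs pw

module Transposition {A : Set} (_≟_ : DecidableEquality A) where

  transpose : A → A → A → A
  transpose a b k with k ≟ a | k ≟ b
  ... | yes _ | _     = b
  ... | no _  | yes _ = a
  ... | no _  | no _  = k

  transpose-left : ∀ a b → transpose a b a ≡ b
  transpose-left a b with a ≟ a
  ... | yes _   = refl
  ... | no a≢a = contradiction refl a≢a

  transpose-right : ∀ a b → transpose a b b ≡ a
  transpose-right a b with b ≟ a | b ≟ b
  ... | yes b≡a | _      = b≡a
  ... | no _    | yes _  = refl
  ... | no _    | no b≢b = contradiction refl b≢b

  transpose-other : ∀ {a b k} → k ≢ a → k ≢ b → transpose a b k ≡ k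
  transpose-other {a} {b} {k} k≢a k≢b with k ≟ a | k ≟ b
  ... | yes k≡a | _       = contradiction k≡a k≢a
  ... | no _    | yes k≡b = contradiction k≡b k≢b
  ... | no _    | no _    = refl

  transpose-involutive : ∀ a b k → transpose a b (transpose a b k) ≡ k
  transpose-involutive a b k with k ≟ a | k ≟ b
  ... | yes refl | _        = transpose-right a b
  ... | no _     | yes refl = transpose-left a b
  ... | no k≢a   | no k≢b   = transpose-other k≢a k≢b

  transposition : A → A → Perm A
  transposition a b = mk↔ₛ′ (transpose a b) (transpose a b) (transpose-involutive a b) (transpose-involutive a b)

open Transposition _≟ⁿ_

Supports : ∀ {n} → List I → Pred n → Set
Supports P α = ∀ π → InGStab P π → Fixes π α

Supports-mono : ∀ {n P Q} {α : Pred n} → P ⊆ Q → Supports P α → Supports Q α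
Supports-mono P⊆Q P-supports π (π∈G , π-fixes-Q) = P-supports π (π∈G , λ p p∈P → π-fixes-Q p (P⊆Q p∈P))

flip : N₁ → N₁
flip zero       = suc zero
flip (suc zero) = zero

flip-≢ : ∀ m → flip m ≢ m
flip-≢ zero       ()
flip-≢ (suc zero) ()

≢⇒≡flip : ∀ {m j : N₁} → m ≢ j → m ≡ flip j
≢⇒≡flip {zero}     {zero}     m≢j = contradiction refl m≢j
≢⇒≡flip {zero}     {suc zero} _   = refl
≢⇒≡flip {suc zero} {zero}     _   = refl
≢⇒≡flip {suc zero} {suc zero} m≢j = contradiction refl m≢j

flip-commutes : (g : Perm N₁) → ∀ m → to g (flip m) ≡ flip (to g m)
flip-commutes g m = ≢⇒≡flip (flip-≢ m ∘ Injection.injective (↔⇒↣ g))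

twin : I → I
twin (n , m) = n , flip m

∈-ownBlock : ∀ {x y : I} → proj₁ y ≡ proj₁ x → y ∈ x ∷ twin x ∷ []
∈-ownBlock {k , j} {.k , m} refl with m ≟ᶠ j
... | yes refl = here refl
... | no m≢j   = there (here (cong (k ,_) (≢⇒≡flip m≢j)))

InG⇒to-twin : ∀ π → InG π → ∀ u → to π (twin u) ≡ twin (to π u)
InG⇒to-twin π (φ , ρ , π≡) (n , m) = begin
  to π (n , flip m)                 ≡⟨ π≡ n (flip m) ⟩
  to φ n , to (ρ n) (flip m)        ≡⟨ cong (to φ n ,_) (flip-commutes (ρ n) m) ⟩
  twin (to φ n , to (ρ n) m)        ≡⟨ cong twin (π≡ n m) ⟨
  twin (to π (n , m))               ∎

InG⇒from-twin : ∀ π → InG π → ∀ z → from π (twin z) ≡ twin (from π z)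
InG⇒from-twin π π∈G z = begin
  from π (twin z)                   ≡⟨ cong (from π ∘ twin) (Inverse.strictlyInverseˡ π z) ⟨
  from π (twin (to π (from π z)))   ≡⟨ cong (from π) (InG⇒to-twin π π∈G (from π z)) ⟨
  from π (to π (twin (from π z)))   ≡⟨ Inverse.strictlyInverseʳ π _ ⟩
  twin (from π z)                   ∎

blockSwap : ℕ → ℕ → Perm I
blockSwap a b = mk↔ₛ′ swap swap involutive involutive
  where
  swap : I → I
  swap (k , m) = transpose a b k , m
  involutive : ∀ u → swap (swap u) ≡ u
  involutive (k , m) = cong (_, m) (transpose-involutive a b k)

blockSwap∈G : ∀ a b → InG (blockSwap a b)
blockSwap∈G a b = transposition a b , (λ _ → ↔-refl) , λ _ _ → refl

blocksBelow : ℕ → List I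
blocksBelow K = cartesianProduct (upTo K) (allFin 2)

∈-blocksBelow : ∀ {K n} m → n < K → (n , m) ∈ blocksBelow K
∈-blocksBelow m n<K = ∈-cartesianProduct⁺ (∈-upTo⁺ n<K) (∈-allFin m)

blockBound : List I → ℕ
blockBound P = suc (max 0 (map proj₁ P))

block<blockBound : ∀ {P p} → p ∈ P → proj₁ p < blockBound P
block<blockBound p∈P = s≤s (All.lookup (xs≤max 0 _) (∈-map⁺ proj₁ p∈P))

blockSwap∈GStab : ∀ P {a b} → blockBound P ≤ a → blockBound P ≤ b → InGStab P (blockSwap a b)
blockSwap∈GStab P {a} {b} M≤a M≤b = blockSwap∈G a b , λ p p∈P →
  cong (_, proj₂ p) (transpose-other (<⇒≢ (<-≤-trans (block<blockBound p∈P) M≤a))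
                                     (<⇒≢ (<-≤-trans (block<blockBound p∈P) M≤b)))

spareBlock : ∀ M k → ∃[ b ] M ≤ b × b < 2 + M × k ≢ b
spareBlock M k with k ≟ⁿ M
... | yes refl = suc M , n≤1+n M , n<1+n (suc M) , ≢-sym 1+n≢n
... | no k≢M   = M , ≤-refl , m≤n⇒m≤1+n (n<1+n M) , k≢M

rel : Pred 2 → I → I → Bool
rel R x y = R (x ∷ y ∷ [])

choose : Pred 2 → (I → List I) → I → Maybe I
choose R candidates x = findᵇ (rel R x) (candidates x)

choose-equivariant : ∀ R candidates (π : Perm I) → Fixes π R →
  (∀ x → candidates (from π x) ≡ map (from π) (candidates x)) →
  ∀ x → choose R candidates (from π x) ≡ Maybe.map (from π) (choose R candidates x)
choose-equivariant R candidates π R-inv candidates-eq x = begin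
  findᵇ (rel R (from π x)) (candidates (from π x))        ≡⟨ cong (findᵇ _) (candidates-eq x) ⟩
  findᵇ (rel R (from π x)) (map (from π) (candidates x))  ≡⟨ findᵇ-map (from π) (λ w → R-inv (x ∷ w ∷ [])) (candidates x) ⟩
  Maybe.map (from π) (choose R candidates x)              ∎

_≟ᴹ_ : DecidableEquality (Maybe I)
_≟ᴹ_ = ≡-decᴹ (≡-dec _≟ⁿ_ _≟ᶠ_)

graph : (I → Maybe I) → Pred 2
graph f (x ∷ y ∷ []) = does (f x ≟ᴹ just y)

≡⇒graph : ∀ f {x y} → f x ≡ just y → graph f (x ∷ y ∷ []) ≡ true
≡⇒graph f {x} {y} = dec-true (f x ≟ᴹ just y)

graph⇒≡ : ∀ f {x y} → graph f (x ∷ y ∷ []) ≡ true → f x ≡ just y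
graph⇒≡ f {x} {y} _ with f x ≟ᴹ just y
graph⇒≡ f _  | yes fx≡y = fx≡y
graph⇒≡ f () | no _

graph-fixes : ∀ (π : Perm I) {f} → (∀ x → f (from π x) ≡ Maybe.map (from π) (f x)) →
              Fixes π (graph f)
graph-fixes π {f} f-eq (x ∷ y ∷ []) = does-⇔ (mk⇔
  (λ e → map-injectiveᴹ (Injection.injective (↔⇒↣ (↔-sym π))) {f x} {just y} (trans (sym (f-eq x)) e))
  (λ e → trans (f-eq x) (cong (Maybe.map (from π)) e)))
  (f (from π x) ≟ᴹ just (from π y)) (f x ≟ᴹ just y)

module SupportedChoice (R : Pred 2) (P : List I) (R-inv : Supports P R) where

  M : ℕ
  M = blockBound P

  Q : List I
  Q = blocksBelow (2 + M)

  P⊆Q : P ⊆ Q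
  P⊆Q {n , m} p∈P = ∈-blocksBelow m (<-≤-trans (block<blockBound p∈P) (m≤n+m M 2))

  candidates : I → List I
  candidates x = Q ++ x ∷ twin x ∷ []

  choice : I → Maybe I
  choice = choose R candidates

  candidates-equivariant : ∀ π → InGStab Q π → ∀ x → candidates (from π x) ≡ map (from π) (candidates x)
  candidates-equivariant π (π∈G , π-fixes-Q) x = sym (begin
    map (from π) (Q ++ x ∷ twin x ∷ [])                ≡⟨ map-++ (from π) Q _ ⟩
    map (from π) Q ++ from π x ∷ from π (twin x) ∷ []  ≡⟨ cong₂ (λ l t → l ++ from π x ∷ t ∷ [])
                                                              (map-id-local (All.tabulate from-fixes))
                                                              (InG⇒from-twin π π∈G x) ⟩
    Q ++ from π x ∷ twin (from π x) ∷ []               ∎)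
    where
    from-fixes : ∀ {q} → q ∈ Q → from π q ≡ q
    from-fixes q∈Q = Inverse.inverseʳ π (sym (π-fixes-Q _ q∈Q))

  graph-choice-supported : Supports Q (graph choice)
  graph-choice-supported π π∈G[Q] =
    graph-fixes π (choose-equivariant R candidates π (Supports-mono P⊆Q R-inv π π∈G[Q])
                                                     (candidates-equivariant π π∈G[Q]))

  rel-blockSwap : ∀ {x y b} → M ≤ proj₁ y → M ≤ b → proj₁ x ≢ proj₁ y → proj₁ x ≢ b →
                  rel R x (b , proj₂ y) ≡ rel R x y
  rel-blockSwap {k , j} {n , m} {b} M≤n M≤b k≢n k≢b = begin
    R ((k , j) ∷ (b , m) ∷ [])
      ≡⟨ cong₂ (λ u v → R ((u , j) ∷ (v , m) ∷ [])) (transpose-other k≢n k≢b) (transpose-left n b) ⟨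
    R ((transpose n b k , j) ∷ (transpose n b n , m) ∷ [])
      ≡⟨ R-inv (blockSwap n b) (blockSwap∈GStab P M≤n M≤b) _ ⟩
    R ((k , j) ∷ (n , m) ∷ [])
      ∎

  candidates-complete : ∀ x y → rel R x y ≡ true → ∃[ w ] w ∈ candidates x × rel R x w ≡ true
  candidates-complete x (n , m) Rxy with n <? 2 + M | n ≟ⁿ proj₁ x
  ... | yes n<2+M | _       = (n , m) , ∈-++⁺ˡ (∈-blocksBelow m n<2+M) , Rxy
  ... | no _      | yes n≡k = (n , m) , ∈-++⁺ʳ Q (∈-ownBlock n≡k) , Rxy
  ... | no n≮2+M  | no n≢k  =
    let (b , M≤b , b<2+M , k≢b) = spareBlock M (proj₁ x)
        M≤n = ≤-trans (m≤n+m M 2) (≮⇒≥ n≮2+M)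
    in (b , m) , ∈-++⁺ˡ (∈-blocksBelow m b<2+M) , trans (rel-blockSwap M≤n M≤b (≢-sym n≢k) k≢b) Rxy

  choice-defined : ∀ x y → rel R x y ≡ true → ∃[ c ] choice x ≡ just c
  choice-defined x y Rxy =
    let (w , w∈candidates , Rxw) = candidates-complete x y Rxy
    in findᵇ-complete (rel R x) (candidates x) w∈candidates Rxw

proposition2p9 : (A : Pred 1) → J 1 A → (R : Pred 2) → J 2 R →
    Σ (Pred 2) λ S → J 2 S ×
    ((∀ x → (A (x ∷ []) ≡ true) ⇔ (∃[ y ] (R (x ∷ y ∷ []) ≡ true))) →
    ∀ x → A (x ∷ []) ≡ true →
    ExactlyOne λ y → (R (x ∷ y ∷ []) ≡ true) × (S (x ∷ y ∷ []) ≡ true))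
proposition2p9 A _ R (P , R-inv) = graph choice , (Q , graph-choice-supported) , λ A⇔∃R x Ax →
  let (y , Rxy)      = Equivalence.to (A⇔∃R x) Ax
      (c , choice≡c) = choice-defined x y Rxy
  in c , (findᵇ-sound (rel R x) (candidates x) choice≡c , ≡⇒graph choice choice≡c) ,
     λ y′ (_ , Sxy′) → just-injective (trans (sym (graph⇒≡ choice Sxy′)) choice≡c)
  where open SupportedChoice R P R-inv
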